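{- Let $G$ be a finite simple connected graph satisfying property (P3), and let $R$ be an induced subgraph of $G$ witnessing (P3). Let $c\in V(R)$ and $x\in V(G)$ with $d(c,x)\ge 2$, and let $c'\in N_R(c,x)$. If for every $y\in V(G)$ with $d(c',y)\ge 2$ either $d(c,y)=d(c',y)+1$ or $d(x,y)=d(x,c')+d(c',y)$, then $c'\in C(c,x)$.
   Context: $d$ is the distance in $G$, $N(x)$ the neighbourhood, $N[x]=N(x)\cup\{x\}$, $N[R]=\bigcup_{r\in V(R)}N[r]$. For $d(c,x)\ge 2$: $N(c,x)=\{v\in N(c): d(c,x)=1+d(v,x)\}$ and $N_R(c,x)=N(c,x)\cap V(R)$. An induced subgraph $R$ witnesses property (P3) if $N[R]=V(G)$ and for all $c\in V(R)$, $x\in V(G)$ with $d(c,x)\ge 2$, there exists $c'\in N_R(c,x)$ such that for every $y\in V(G)$ with $d(c',y)\ge 2$, either $d(c,y)=d(c,c')+d(c',y)$ or $d(x,y)=d(x,c')+d(c',y)$; $G$ satisfies (P3) if such $R$ exists. For $c\in V(R)$, $x\in V(G)$ with $d(c,x)\ge2$, define $C(c,x)=\{u\in N_R(c,x): N[u]\supseteq N[v]\text{ for all }v\in N(c,x)\}$. -}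

module Defs where

open import Data.Nat using (ℕ; zero; suc; _+_; _≤_)
open import Data.Bool using (Bool; true; false; if_then_else_; _∧_; _∨_)
open import Data.Fin using (Fin)
open import Data.Fin.Subset using (Subset; _∈_)
open import Data.List using (List; allFin)
open import Data.Bool.ListAction using (any)
open import Data.Product using (Σ; _×_; ∃; ∃-syntax)
open import Data.Sum using (_⊎_)
open import Relation.Binary.PropositionalEquality using (_≡_)
open import Relation.Nullary.Decidable using (⌊_⌋)
open import Data.Fin using (_≟_)

record Graph (n : ℕ) : Set where
  field
    adj     : Fin n → Fin n → Bool
    adj-sym : ∀ u v → adj u v ≡ adj v u
    irrefl  : ∀ v → adj v v ≡ false
open Graph public

module _ {n : ℕ} (G : Graph n) where

  Adj : Fin n → Fin n → Set
  Adj u v = adj G u v ≡ true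

  data Walk : Fin n → Fin n → ℕ → Set where
    here : ∀ {u} → Walk u u 0
    step : ∀ {u w v k} → Adj u w → Walk w v k → Walk u v (suc k)

  Connected : Set
  Connected = ∀ u v → ∃[ k ] Walk u v k

  reach : ℕ → Fin n → Fin n → Bool
  reach zero    u v = ⌊ u ≟ v ⌋
  reach (suc k) u v = reach k u v ∨ any (λ w → reach k u w ∧ adj G w v) (allFin n)

search : ℕ → ℕ → (ℕ → Bool) → ℕ
search zero    s f = s
search (suc m) s f = if f s then s else search m (suc s) f

module _ {n : ℕ} (G : Graph n) where

  -- graph distance d(u,v): least k with a walk of length ≤ k (well defined
  -- for connected graphs, where d(u,v) ≤ n - 1)
  dist : Fin n → Fin n → ℕ
  dist u v = search n 0 (λ k → reach G k u v)

  InClosedNbhd : Fin n → Fin n → Set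
  InClosedNbhd x v = v ≡ x ⊎ Adj G x v

  InNcx : Fin n → Fin n → Fin n → Set
  InNcx c x v = Adj G c v × dist c x ≡ 1 + dist v x

  InNRcx : Subset n → Fin n → Fin n → Fin n → Set
  InNRcx R c x v = InNcx c x v × v ∈ R

  InC : Subset n → Fin n → Fin n → Fin n → Set
  InC R c x u = InNRcx R c x u ×
    (∀ v → InNcx c x v → ∀ w → InClosedNbhd v w → InClosedNbhd u w)

  Dominating : Subset n → Set
  Dominating R = ∀ v → ∃[ r ] (r ∈ R × InClosedNbhd r v)

  WitnessP3 : Subset n → Set
  WitnessP3 R = Dominating R ×
    (∀ c x → c ∈ R → 2 ≤ dist c x →
      ∃[ c' ] (InNRcx R c x c' ×
        (∀ y → 2 ≤ dist c' y →
          (dist c y ≡ dist c c' + dist c' y) ⊎ (dist x y ≡ dist x c' + dist c' y))))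

  SatisfiesP3 : Set
  SatisfiesP3 = ∃[ R ] WitnessP3 R

-- A vertex w ∈ N[v] with v ∈ N(c,x) lies within distance 2 of c and within
-- distance d(x,v) + 1 = d(x,c') + 1 of x.  If w ∉ N[c'] then d(c',w) ≥ 2, so
-- the first alternative would give d(c,w) ≥ 3 and the second
-- d(x,w) ≥ d(x,c') + 2; hence w ∈ N[c'].
module Submission where

open import Defs
open import Data.Nat using (ℕ; zero; suc; _+_; _≤_; _≤′_; ≤′-refl; ≤′-step; z≤n; s≤s; _≤?_)
open import Data.Nat.Properties
  using (≤-antisym; ≤-trans; ≤-reflexive; m≤n⇒m<n∨m≡n; m≤m+n; m≤n+m; ≤⇒≤′; ≰⇒>;
         <-irrefl; +-identityʳ; +-suc; +-mono-≤; +-monoˡ-≤; +-monoʳ-≤;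
         +-cancelˡ-≤; suc-injective; module ≤-Reasoning)
open import Data.Bool using (Bool; true; false; T)
open import Data.Bool.Properties using (T-∨; T-∧; T-≡)
open import Data.Fin using (Fin) renaming (zero to fzero)
open import Data.Fin.Subset using (Subset; _∈_)
open import Data.List using (allFin)
open import Data.List.Relation.Unary.Any using (satisfied)
open import Data.List.Relation.Unary.Any.Properties using (any⁺; any⁻)
open import Data.List.Membership.Propositional using (lose)
open import Data.List.Membership.Propositional.Properties using (∈-allFin)
open import Data.Product using (_×_; _,_; proj₁; proj₂; ∃-syntax)
open import Data.Sum using (_⊎_; inj₁; inj₂; [_,_])
open import Data.Empty using (⊥-elim)
open import Function.Base using (_∘_)
open import Function.Bundles using (Equivalence)
open import Relation.Nullary using (yes; no)
open import Relation.Nullary.Decidable using (toWitness; fromWitness)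
open import Relation.Binary.PropositionalEquality using (_≡_; _≢_; refl; sym; trans; subst)

open Equivalence using (to; from)

search-≤ : ∀ m s (f : ℕ → Bool) → search m s f ≤ s + m
search-≤ zero    s f = ≤-reflexive (sym (+-identityʳ s))
search-≤ (suc m) s f with f s
... | true  = m≤m+n s (suc m)
... | false = ≤-trans (search-≤ m (suc s) f) (≤-reflexive (sym (+-suc s m)))

search-least : ∀ m s (f : ℕ → Bool) {k} → s ≤ k → T (f k) → search m s f ≤ k
search-least zero    s f s≤k fk = s≤k
search-least (suc m) s f s≤k fk with f s in fs≡ | m≤n⇒m<n∨m≡n s≤k
... | true  | _        = s≤k
... | false | inj₁ s<k = search-least m (suc s) f s<k fk
... | false | inj₂ refl = ⊥-elim (subst T fs≡ fk)

search-found : ∀ m s (f : ℕ → Bool) → T (f (search m s f)) ⊎ search m s f ≡ s + m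
search-found zero    s f = inj₂ (sym (+-identityʳ s))
search-found (suc m) s f with f s in fs≡
... | true  = inj₁ (subst T (sym fs≡) _)
... | false with search-found m (suc s) f
...   | inj₁ found = inj₁ found
...   | inj₂ s+m   = inj₂ (trans s+m (sym (+-suc s m)))

Fin-≤1-irrelevant : ∀ {m} → m ≤ 1 → (i j : Fin m) → i ≡ j
Fin-≤1-irrelevant (s≤s z≤n) fzero fzero = refl

module _ {n : ℕ} (G : Graph n) where

  Adj-sym : ∀ {u v} → Adj G u v → Adj G v u
  Adj-sym {u} {v} a = trans (adj-sym G v u) a

  -- Unlike T (reach G k u v), this type determines k, u and v, so they can be inferred.
  record Reaches (k : ℕ) (u v : Fin n) : Set where
    constructor reaches
    field reach-true : T (reach G k u v)

  Reaches-0⇒≡ : ∀ {u v} → Reaches 0 u v → u ≡ v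
  Reaches-0⇒≡ (reaches r) = toWitness r

  Reaches-refl : ∀ {u} → Reaches 0 u u
  Reaches-refl = reaches (fromWitness refl)

  Reaches-suc⁻ : ∀ {k u v} → Reaches (suc k) u v →
    Reaches k u v ⊎ ∃[ w ] (Reaches k u w × Adj G w v)
  Reaches-suc⁻ (reaches r) with to T-∨ r
  ... | inj₁ r′ = inj₁ (reaches r′)
  ... | inj₂ r′ with satisfied (any⁻ _ (allFin n) r′)
  ...   | w , r∧a with to T-∧ r∧a
  ...     | r″ , a = inj₂ (w , reaches r″ , to T-≡ a)

  Reaches-weaken : ∀ {k u v} → Reaches k u v → Reaches (suc k) u v
  Reaches-weaken (reaches r) = reaches (from T-∨ (inj₁ r))

  Reaches-snoc : ∀ {k u w v} → Reaches k u w → Adj G w v → Reaches (suc k) u v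
  Reaches-snoc {w = w} (reaches r) a =
    reaches (from T-∨ (inj₂ (any⁺ _ (lose (∈-allFin w) (from T-∧ (r , from T-≡ a))))))

  Reaches-mono : ∀ {j k u v} → j ≤′ k → Reaches j u v → Reaches k u v
  Reaches-mono ≤′-refl       r = r
  Reaches-mono (≤′-step j≤k) r = Reaches-weaken (Reaches-mono j≤k r)

  Adj⇒Reaches-1 : ∀ {u v} → Adj G u v → Reaches 1 u v
  Adj⇒Reaches-1 = Reaches-snoc Reaches-refl

  closedNbhd⇒Reaches-1 : ∀ {u v} → InClosedNbhd G u v → Reaches 1 u v
  closedNbhd⇒Reaches-1 (inj₁ refl) = Reaches-weaken Reaches-refl
  closedNbhd⇒Reaches-1 (inj₂ a)    = Adj⇒Reaches-1 a

  Reaches-1⇒closedNbhd : ∀ {u v} → Reaches 1 u v → InClosedNbhd G u v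
  Reaches-1⇒closedNbhd r with Reaches-suc⁻ r
  ... | inj₁ r₀ = inj₁ (sym (Reaches-0⇒≡ r₀))
  ... | inj₂ (w , r₀ , a) with Reaches-0⇒≡ r₀
  ...   | refl = inj₂ a

  Reaches-++ : ∀ {j k u v w} → Reaches j u v → Reaches k v w → Reaches (j + k) u w
  Reaches-++ {j} {zero} r s with Reaches-0⇒≡ s
  ... | refl rewrite +-identityʳ j = r
  Reaches-++ {j} {suc k} r s rewrite +-suc j k with Reaches-suc⁻ s
  ... | inj₁ s′           = Reaches-weaken (Reaches-++ r s′)
  ... | inj₂ (z , s′ , a) = Reaches-snoc (Reaches-++ r s′) a

  Reaches-sym : ∀ {k u v} → Reaches k u v → Reaches k v u
  Reaches-sym {zero} r with Reaches-0⇒≡ r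
  ... | refl = r
  Reaches-sym {suc k} r with Reaches-suc⁻ r
  ... | inj₁ r′ = Reaches-weaken (Reaches-sym r′)
  ... | inj₂ (w , r′ , a) = Reaches-++ {1} (Adj⇒Reaches-1 (Adj-sym a)) (Reaches-sym r′)

  dist≤n : ∀ u v → dist G u v ≤ n
  dist≤n u v = search-≤ n 0 _

  dist-least : ∀ {k u v} → Reaches k u v → dist G u v ≤ k
  dist-least (reaches r) = search-least n 0 _ z≤n r

  -- dist G u v = n is the junk value when v cannot be reached from u.
  dist-reaches : ∀ u v → Reaches (dist G u v) u v ⊎ dist G u v ≡ n
  dist-reaches u v with search-found n 0 (λ k → reach G k u v)
  ... | inj₁ r   = inj₁ (reaches r)
  ... | inj₂ d≡n = inj₂ d≡n

  dist-sym-≤ : ∀ u v → dist G u v ≤ dist G v u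
  dist-sym-≤ u v with dist-reaches v u
  ... | inj₁ r   = dist-least (Reaches-sym r)
  ... | inj₂ d≡n = subst (dist G u v ≤_) (sym d≡n) (dist≤n u v)

  dist-sym : ∀ u v → dist G u v ≡ dist G v u
  dist-sym u v = ≤-antisym (dist-sym-≤ u v) (dist-sym-≤ v u)

  dist-triangle : ∀ u v w → dist G u w ≤ dist G u v + dist G v w
  dist-triangle u v w with dist-reaches u v | dist-reaches v w
  ... | inj₁ r   | inj₁ s   = dist-least (Reaches-++ r s)
  ... | inj₂ d≡n | _        = ≤-trans (dist≤n u w) (≤-trans (≤-reflexive (sym d≡n)) (m≤m+n _ _))
  ... | _        | inj₂ d≡n = ≤-trans (dist≤n u w) (≤-trans (≤-reflexive (sym d≡n)) (m≤n+m _ _))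

  closedNbhd⇒dist≤1 : ∀ {u v} → InClosedNbhd G u v → dist G u v ≤ 1
  closedNbhd⇒dist≤1 = dist-least ∘ closedNbhd⇒Reaches-1

  dist≤1⇒closedNbhd : ∀ {u v} → dist G u v ≤ 1 → InClosedNbhd G u v
  dist≤1⇒closedNbhd {u} {v} d≤1 with dist-reaches u v
  ... | inj₁ r   = Reaches-1⇒closedNbhd (Reaches-mono (≤⇒≤′ d≤1) r)
  ... | inj₂ d≡n = inj₁ (Fin-≤1-irrelevant (subst (_≤ 1) d≡n d≤1) v u)

  closedNbhd-⊆ : ∀ c x c' → dist G c x ≡ 1 + dist G c' x →
    (∀ y → 2 ≤ dist G c' y →
      (dist G c y ≡ dist G c' y + 1) ⊎ (dist G x y ≡ dist G x c' + dist G c' y)) →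
    ∀ v → InNcx G c x v → ∀ w → InClosedNbhd G v w → InClosedNbhd G c' w
  closedNbhd-⊆ c x c' dcx alternatives v (cv , dvx) w vw with dist G c' w ≤? 1
  ... | yes d≤1 = dist≤1⇒closedNbhd d≤1
  ... | no  d≰1 = ⊥-elim ([ too-far-from-c , too-far-from-x ] (alternatives w 2≤d))
    where
    open ≤-Reasoning

    2≤d : 2 ≤ dist G c' w
    2≤d = ≰⇒> d≰1

    xv≡xc' : dist G x v ≡ dist G x c'
    xv≡xc' = trans (dist-sym x v) (trans (suc-injective (trans (sym dvx) dcx)) (dist-sym c' x))

    too-far-from-c : dist G c w ≢ dist G c' w + 1
    too-far-from-c e = <-irrefl refl (begin
      3                               ≤⟨ +-monoˡ-≤ 1 2≤d ⟩
      dist G c' w + 1                 ≡⟨ e ⟨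
      dist G c w                      ≤⟨ dist-triangle c v w ⟩
      dist G c v + dist G v w         ≤⟨ +-mono-≤ (closedNbhd⇒dist≤1 (inj₂ cv)) (closedNbhd⇒dist≤1 vw) ⟩
      2                               ∎)

    too-far-from-x : dist G x w ≢ dist G x c' + dist G c' w
    too-far-from-x e = <-irrefl refl (+-cancelˡ-≤ (dist G x c') 2 1 (begin
      dist G x c' + 2                 ≤⟨ +-monoʳ-≤ (dist G x c') 2≤d ⟩
      dist G x c' + dist G c' w       ≡⟨ e ⟨
      dist G x w                      ≤⟨ dist-triangle x v w ⟩
      dist G x v + dist G v w         ≤⟨ +-mono-≤ (≤-reflexive xv≡xc') (closedNbhd⇒dist≤1 vw) ⟩
      dist G x c' + 1                 ∎))

lemma1 : ∀ {n : ℕ} (G : Graph n) → Connected G → SatisfiesP3 G →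
    (R : Subset n) → WitnessP3 G R →
    (c x : Fin n) → c ∈ R → 2 ≤ dist G c x →
    (c' : Fin n) → InNRcx G R c x c' →
    (∀ y → 2 ≤ dist G c' y →
      (dist G c y ≡ dist G c' y + 1) ⊎ (dist G x y ≡ dist G x c' + dist G c' y)) →
    InC G R c x c'
lemma1 G _ _ R _ c x _ _ c' c'∈NR alternatives =
  c'∈NR , closedNbhd-⊆ G c x c' (proj₂ (proj₁ c'∈NR)) alternatives
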